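{- Let $k,n$ be positive integers with $k>n$, let $C_{k;n}$ be the finite cyclic semigroup of index $k$ and period $n$ with unique idempotent $\mathbf{e}$, and let $T$ be a nonempty sequence over $C_{k;n}$. Let $\delta$ be an integer with $1\le \delta\le \left\lceil \frac{\lceil k/n\rceil n}{2}\right\rceil-\frac{3n}{2}$. If $N(T;\mathbf{e})<2^{|T|-\lceil k/n\rceil n+1+\delta}-1$, then the sequence of integers $({\rm Ind}(a))_{a\mid T}$ has the form $$1^{[|T|-u]}\cdot x_1\cdot\ldots\cdot x_u$$ (i.e. $|T|-u$ copies of $1$ together with $x_1,\dots,x_u$), where $x_1,\dots,x_u\ge 2$ and $u\le\sum_{i=1}^u(x_i-1)\le\delta-1$.
   Context: $C_{k;n}=\langle s\rangle$ is the cyclic semigroup (written additively) generated by $s$ with index $k$ and period $n$; its elements are $s,2s,\dots,(k+n-1)s$, and it has a unique idempotent $\mathbf{e}$. For $a\in C_{k;n}$, ${\rm Ind}(a)$ is the least positive integer $t$ with $ts=a$. Sequences are finite unordered lists with repetition; subsequences are indexed by subsets of positions and those with different index sets are counted as distinct. $N(T;\mathbf{e})$ is the number of distinct nonempty subsequences of $T$ whose sum is $\mathbf{e}$ (since $k>1$, the empty subsequence is not counted). -}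

module Defs where

open import Data.Nat using (ℕ; zero; suc; pred; _+_; _*_; _∸_; _<_; _≤_; _<?_; NonZero)
open import Data.Nat.Properties using (<⇒≤pred; ≤-trans; m≤m+n; +-monoʳ-<)
open import Data.Nat.DivMod using (_/_; _%_; m%n<n)
open import Data.Fin using (Fin; toℕ; fromℕ<) renaming (_≟_ to _≟F_)
open import Data.List using (List; []; _∷_; map; _++_)
open import Relation.Binary.PropositionalEquality using (_≡_)
open import Relation.Nullary using (yes; no)

⌈_/_⌉ : ℕ → (b : ℕ) → .{{NonZero b}} → ℕ
⌈ a / b ⌉ = (a + b ∸ 1) / b

-- Its elements are s, 2s, …, (k+n-1)s; the element ts (1 ≤ t ≤ k+n-1)
-- is represented by i : Fin (pred k + n) with toℕ i = t - 1.
record C (k n : ℕ) : Set where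
  constructor elt
  field idx : Fin (pred k + n)
open C public

Ind : ∀ {k n} → C k n → ℕ
Ind a = suc (toℕ (idx a))

-- Reduction of the multiple ts, t = m + 1, to its canonical representative:
-- ts = t's iff t = t', or t, t' ≥ k and t ≡ t' (mod n).
-- Returns (canonical t) - 1.
red : (k n : ℕ) .{{_ : NonZero n}} → ℕ → ℕ
red k n m with suc m <? k
... | yes _ = m
... | no  _ = pred k + (suc m ∸ k) % n

red-bound : (k n : ℕ) .{{_ : NonZero n}} (m : ℕ) → red k n m < pred k + n
red-bound k n m with suc m <? k
... | yes p = ≤-trans (<⇒≤pred p) (m≤m+n (pred k) n)
... | no  _ = +-monoʳ-< (pred k) (m%n<n (suc m ∸ k) n)

-- The semigroup operation: ts + t's = (t + t')s.
_⊕_ : ∀ {k n} .{{_ : NonZero n}} → C k n → C k n → C k n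
_⊕_ {k} {n} a b = elt (fromℕ< (red-bound k n (suc (toℕ (idx a) + toℕ (idx b)))))

σ⁺ : ∀ {k n} .{{_ : NonZero n}} → C k n → List (C k n) → C k n
σ⁺ a []       = a
σ⁺ a (b ∷ bs) = a ⊕ σ⁺ b bs

-- All subsequences, indexed by subsets of positions (2^|T| of them,
-- subsequences with different index sets listed separately).
subseqs : {A : Set} → List A → List (List A)
subseqs []       = [] ∷ []
subseqs (x ∷ xs) = map (x ∷_) (subseqs xs) ++ subseqs xs

-- Idempotents of C_{k;n}; C_{k;n} has a unique idempotent 𝐞, so
-- "σ(S) = 𝐞" is "σ(S) is idempotent".
IsIdempotent : ∀ {k n} .{{_ : NonZero n}} → C k n → Set
IsIdempotent x = x ⊕ x ≡ x

count𝐞 : ∀ {k n} .{{_ : NonZero n}} → List (List (C k n)) → ℕ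
count𝐞 []               = 0
count𝐞 ([] ∷ Ss)        = count𝐞 Ss
count𝐞 ((a ∷ as) ∷ Ss) with idx (σ⁺ a as ⊕ σ⁺ a as) ≟F idx (σ⁺ a as)
... | yes _ = suc (count𝐞 Ss)
... | no  _ = count𝐞 Ss

N𝐞 : ∀ {k n} .{{_ : NonZero n}} → List (C k n) → ℕ
N𝐞 T = count𝐞 (subseqs T)

-- A subsequence of T sums to 𝐞 exactly when its index sum t satisfies k ≤ t and n ∣ t, so
-- N(T; 𝐞) only depends on the multiset M of indices. Put K = ⌈k/n⌉n and suppose the excess
-- Σ (x - 1) over the indices x ≥ 2 is at least δ. Split M into P, L and D such that the set R
-- of residues mod n of subsums of D satisfies R + x ⊆ R for every x in P and in L, and
-- ΣL ≥ K - n. For a nonempty S ⊆ P the residue of -(ΣS + ΣL) then lies in R, so S, L and a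
-- part of D together sum to a multiple of n above K - n, hence to one ≥ K ≥ k; this gives
-- N(T; 𝐞) ≥ 2^|P| - 1. With at least n - 1 ones, D consists of n - 1 ones (so R is everything)
-- and L of a few more indices; otherwise D is grown greedily from the ones, each new element
-- enlarging R, so |D| < n, and L is a short prefix of the remaining indices. In both cases the
-- bound on δ gives |L| + |D| + 1 + δ ≤ K, i.e. |P| ≥ |T| + 1 + δ - K, contradicting the
-- hypothesis on N(T; 𝐞).
module Submission where

open import Data.Fin using (toℕ; fromℕ<) renaming (_≟_ to _≟F_)
import Data.Fin.Properties as Fin
open import Data.Fin.Properties using (toℕ-fromℕ<; toℕ-injective; toℕ<n)
open import Data.Fin.Subset using (Subset; _⊂_; ∣_∣; inside) renaming (_∈_ to _∈ₛ_)
open import Data.Fin.Subset.Properties using (⊥⊆; ∉⊥; ∣⊥∣≡0; ∣p∣≤n; p⊂q⇒∣p∣<∣q∣)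
open import Data.List using (List; []; _∷_; map; _++_; length; replicate; [_])
open import Data.List.Membership.Propositional using (_∈_; find; lose)
open import Data.List.Membership.Propositional.Properties using (∈-map⁺; ∈-map⁻; ∈-++⁺ˡ; ∈-++⁺ʳ; ∈-++⁻)
open import Data.List.Properties using (map-++; map-∘; map-cong; length-++; length-replicate; length-map)
open import Data.List.Relation.Binary.Permutation.Propositional
  using (_↭_; prep; swap; ↭-sym) renaming (refl to ↭-refl; trans to ↭-trans)
open import Data.List.Relation.Binary.Permutation.Propositional.Properties
  using (shift; All-resp-↭; ↭-length; ++-commutativeMonoid) renaming (++⁺ˡ to ↭-++⁺ˡ)
open import Data.List.Relation.Binary.Sublist.Propositional using (_⊆_; []; _∷ʳ_; _∷_; ⊆-refl)
open import Data.List.Relation.Binary.Sublist.Propositional.Properties using () renaming (++⁺ to ⊆-++⁺)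
import Data.List.Relation.Unary.All as All
open import Data.List.Relation.Unary.All using (All; []; _∷_)
open import Data.List.Relation.Unary.All.Properties using (++⁻ˡ; ++⁻ʳ)
import Data.List.Relation.Unary.Any as Any
open import Data.List.Relation.Unary.Any using (Any; here; any?)
open import Data.List.Relation.Unary.Any.Properties using (map⁺; map⁻; ++⁺ˡ; ++⁺ʳ; ++⁻)
open import Data.Nat using (ℕ; zero; suc; pred; _+_; _*_; _∸_; _^_; _<_; _≤_; NonZero; _≤?_; _<?_;
  s≤s; z≤n; s≤s⁻¹; s<s⁻¹; >-nonZero⁻¹)
open import Data.Nat.DivMod
open import Data.Nat.Divisibility using (_∣_; _∣?_; divides; m%n≡0⇒n∣m; n∣m⇒m%n≡0; m∣m*n; n∣m*n)
open import Data.Nat.ListAction using (sum)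
open import Data.Nat.ListAction.Properties using (sum-++)
open import Data.Nat.Properties
open import Algebra.Properties.CommutativeSemigroup +-commutativeSemigroup using (x∙yz≈y∙xz; xy∙z≈xz∙y; interchange)
open import Data.Nat.Tactic.RingSolver using (solve-∀)
open import Data.Product using (Σ; _×_; _,_; ∃; ∃₂)
open import Data.Sum using (_⊎_; inj₁; inj₂)
open import Data.Vec using (tabulate)
open import Data.Vec.Properties using (lookup∘tabulate; lookup⇒[]=; []=⇒lookup)
open import Function using (_∘_; _⇔_; mk⇔; Equivalence)
open import Relation.Binary.PropositionalEquality
  using (_≡_; _≢_; refl; sym; trans; cong; cong₂; subst; subst₂; module ≡-Reasoning)
open import Relation.Nullary using (Dec; does; yes; no; ¬_; contradiction)
open import Relation.Nullary.Decidable using (_×-dec_; ¬?; dec-true; map′)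

open import Algebra.Solver.CommutativeMonoid (++-commutativeMonoid {A = ℕ})
  using (solve; _⊜_) renaming (_⊕_ to _⊎ₗ_)
open import Defs

%-+-cong : ∀ {a b c d} n .{{_ : NonZero n}} → a % n ≡ b % n → c % n ≡ d % n → (a + c) % n ≡ (b + d) % n
%-+-cong {a} {b} {c} {d} n a≡b c≡d = begin
  (a + c) % n          ≡⟨ %-distribˡ-+ a c n ⟩
  (a % n + c % n) % n  ≡⟨ cong₂ (λ x y → (x + y) % n) a≡b c≡d ⟩
  (b % n + d % n) % n  ≡⟨ %-distribˡ-+ b d n ⟨
  (b + d) % n          ∎
  where open ≡-Reasoning

%-cancelˡ-+ : ∀ m {i j} n .{{_ : NonZero n}} → (m + i) % n ≡ (m + j) % n → i % n ≡ j % n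
%-cancelˡ-+ m {i} {j} n eq = begin
  i % n                      ≡⟨ complement i ⟨
  (n ∸ m % n + (m + i)) % n  ≡⟨ %-+-cong {n ∸ m % n} n refl eq ⟩
  (n ∸ m % n + (m + j)) % n  ≡⟨ complement j ⟩
  j % n                      ∎
  where
  open ≡-Reasoning
  complement : ∀ x → (n ∸ m % n + (m + x)) % n ≡ x % n
  complement x = begin
    (n ∸ m % n + (m + x)) % n      ≡⟨ %-+-cong {n ∸ m % n} n refl (%-+-cong {c = x} n (sym (m%n%n≡m%n m n)) refl) ⟩
    (n ∸ m % n + (m % n + x)) % n  ≡⟨ cong (_% n) (+-assoc (n ∸ m % n) (m % n) x) ⟨
    (n ∸ m % n + m % n + x) % n    ≡⟨ cong (λ z → (z + x) % n) (m∸n+n≡m (m%n≤n m n)) ⟩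
    (n + x) % n                    ≡⟨ cong (_% n) (+-comm n x) ⟩
    (x + n) % n                    ≡⟨ [m+n]%n≡m%n x n ⟩
    x % n                          ∎

multiples-gap : ∀ {n t w} → n ∣ t → n ∣ w → t < w → n + t ≤ w
multiples-gap {n} (divides p refl) (divides q refl) pn<qn = *-monoˡ-≤ n (*-cancelʳ-< n p q pn<qn)

m≤⌈m/n⌉*n : ∀ m n .{{_ : NonZero n}} → m ≤ ⌈ m / n ⌉ * n
m≤⌈m/n⌉*n m n = +-cancelʳ-≤ (n ∸ 1) m (w / n * n) (begin
  m + (n ∸ 1)          ≡⟨ +-∸-assoc m (>-nonZero⁻¹ n) ⟨
  w                    ≡⟨ m≡m%n+[m/n]*n w n ⟩
  w % n + w / n * n    ≤⟨ +-monoˡ-≤ (w / n * n) (<⇒≤pred (m%n<n w n)) ⟩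
  pred n + w / n * n   ≡⟨ +-comm (pred n) (w / n * n) ⟩
  w / n * n + (n ∸ 1)  ∎)
  where
  open ≤-Reasoning
  w = m + n ∸ 1

2*⌈m/2⌉≤m+1 : ∀ m → 2 * ⌈ m / 2 ⌉ ≤ m + 1
2*⌈m/2⌉≤m+1 m = begin
  2 * ((m + 2 ∸ 1) / 2)  ≡⟨ *-comm 2 ((m + 2 ∸ 1) / 2) ⟩
  (m + 2 ∸ 1) / 2 * 2    ≤⟨ m/n*n≤m (m + 2 ∸ 1) 2 ⟩
  m + 2 ∸ 1              ≡⟨ +-∸-assoc m (s≤s z≤n) ⟩
  m + 1                  ∎
  where open ≤-Reasoning

δ-bound⇒δ-small : ∀ n t δ → 2 * δ + 3 * n ≤ 2 * ⌈ (n + t) / 2 ⌉ → 2 * δ + 2 * n ≤ t + 1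
δ-bound⇒δ-small n t δ δ-bound = +-cancelˡ-≤ n _ _ (begin
  n + (2 * δ + 2 * n)  ≡⟨ e δ n ⟩
  2 * δ + 3 * n        ≤⟨ ≤-trans δ-bound (2*⌈m/2⌉≤m+1 (n + t)) ⟩
  n + t + 1            ≡⟨ +-assoc n t 1 ⟩
  n + (t + 1)          ∎)
  where
  open ≤-Reasoning
  e : ∀ δ n → n + (2 * δ + 2 * n) ≡ 2 * δ + 3 * n
  e = solve-∀

sum-replicate : ∀ i x → sum (replicate i x) ≡ i * x
sum-replicate zero    x = refl
sum-replicate (suc i) x = cong (x +_) (sum-replicate i x)

replicate-+ : ∀ {A : Set} i j (x : A) → replicate (i + j) x ≡ replicate i x ++ replicate j x
replicate-+ zero    j x = refl
replicate-+ (suc i) j x = cong (x ∷_) (replicate-+ i j x)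

length-replicate-++ : ∀ {A : Set} a {x : A} {ys} → length (replicate a x ++ ys) ≡ a + length ys
length-replicate-++ a {ys = ys} = trans (length-++ (replicate a _)) (cong (_+ length ys) (length-replicate a))

↭-replicate-++⇒length∸ : ∀ {A : Set} {xs ys : List A} {a x} → xs ↭ replicate a x ++ ys → length xs ∸ length ys ≡ a
↭-replicate-++⇒length∸ {ys = ys} {a} xs↭ =
  trans (cong (_∸ length ys) (trans (↭-length xs↭) (length-replicate-++ a))) (m+n∸n≡m a (length ys))

[]∈subseqs : ∀ {A : Set} (xs : List A) → [] ∈ subseqs xs
[]∈subseqs []       = here refl
[]∈subseqs (x ∷ xs) = ∈-++⁺ʳ (map (x ∷_) (subseqs xs)) ([]∈subseqs xs)

replicate∈subseqs : ∀ {A : Set} (x : A) {i j} → i ≤ j → replicate i x ∈ subseqs (replicate j x)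
replicate∈subseqs x {zero}  {j}     _         = []∈subseqs (replicate j x)
replicate∈subseqs x {suc i} {suc j} (s≤s i≤j) = ∈-++⁺ˡ (∈-map⁺ (x ∷_) (replicate∈subseqs x i≤j))

∈subseqs⇒⊆ : ∀ {A : Set} {G xs : List A} → G ∈ subseqs xs → G ⊆ xs
∈subseqs⇒⊆ {xs = []}     (here refl) = []
∈subseqs⇒⊆ {xs = x ∷ xs} G∈ with ∈-++⁻ (map (x ∷_) (subseqs xs)) G∈
... | inj₂ G∈xs = x ∷ʳ ∈subseqs⇒⊆ G∈xs
... | inj₁ G∈x∷ with ∈-map⁻ (x ∷_) G∈x∷
...   | _ , G′∈ , refl = refl ∷ ∈subseqs⇒⊆ G′∈

sum-mono-⊆ : ∀ {G F} → G ⊆ F → sum G ≤ sum F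
sum-mono-⊆ []           = z≤n
sum-mono-⊆ (y ∷ʳ G⊆F)   = ≤-trans (sum-mono-⊆ G⊆F) (m≤n+m _ y)
sum-mono-⊆ (refl ∷ G⊆F) = +-monoʳ-≤ _ (sum-mono-⊆ G⊆F)

excess : List ℕ → ℕ
excess xs = sum (map (λ x → x ∸ 1) xs)

sum≡length+excess : ∀ {xs} → All (1 ≤_) xs → sum xs ≡ length xs + excess xs
sum≡length+excess []                      = refl
sum≡length+excess {suc x ∷ xs} (_ ∷ xs≥1) =
  cong suc (trans (cong (x +_) (sum≡length+excess xs≥1)) (x∙yz≈y∙xz x (length xs) (excess xs)))

length≤excess : ∀ {xs} → All (2 ≤_) xs → length xs ≤ excess xs
length≤excess []                                        = z≤n
length≤excess {suc (suc x) ∷ xs} (s≤s (s≤s z≤n) ∷ xs≥2) = s≤s (≤-trans (length≤excess xs≥2) (m≤n+m _ x))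

2*length≤sum : ∀ {xs} → All (2 ≤_) xs → 2 * length xs ≤ sum xs
2*length≤sum {xs} xs≥2 = begin
  2 * length xs          ≡⟨ cong (length xs +_) (+-identityʳ (length xs)) ⟩
  length xs + length xs  ≤⟨ +-monoʳ-≤ (length xs) (length≤excess xs≥2) ⟩
  length xs + excess xs  ≡⟨ sum≡length+excess (All.map (≤-trans (n≤1+n 1)) xs≥2) ⟨
  sum xs                 ∎
  where open ≤-Reasoning

shortPrefix : ∀ t W → All (2 ≤_) W → t ≤ sum W →
              ∃₂ λ L R → W ≡ L ++ R × t ≤ sum L × 2 * length L ≤ t + 1
shortPrefix zero    W       _           _      = [] , W , refl , z≤n , z≤n
shortPrefix (suc t) (x ∷ W) (x≥2 ∷ W≥2) t<x+ΣW with suc t ≤? x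
... | yes t<x = [ x ] , W , refl , ≤-trans t<x (m≤m+n x 0) , s≤s (m≤n+m 1 t)
... | no t≮x with shortPrefix (suc t ∸ x) W W≥2 (m≤n+o⇒m∸n≤o (suc t) x t<x+ΣW)
...   | L , R , refl , rest≤ΣL , 2|L|≤ = x ∷ L , R , refl , t<x+ΣL , 2|x∷L|≤
  where
  x+rest≡ : x + (suc t ∸ x) ≡ suc t
  x+rest≡ = m+[n∸m]≡n (≰⇒≥ t≮x)
  t<x+ΣL : suc t ≤ x + sum L
  t<x+ΣL = subst (_≤ x + sum L) x+rest≡ (+-monoʳ-≤ x rest≤ΣL)
  2|x∷L|≤ : 2 * length (x ∷ L) ≤ suc t + 1
  2|x∷L|≤ = begin
    2 * suc (length L)   ≡⟨ *-suc 2 (length L) ⟩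
    2 + 2 * length L     ≤⟨ +-mono-≤ x≥2 2|L|≤ ⟩
    x + (suc t ∸ x + 1)  ≡⟨ +-assoc x _ 1 ⟨
    x + (suc t ∸ x) + 1  ≡⟨ cong (_+ 1) x+rest≡ ⟩
    suc t + 1            ∎
    where open ≤-Reasoning

separateOnes : ∀ {xs} → All (1 ≤_) xs → ∃₂ λ a ys → xs ↭ replicate a 1 ++ ys × All (2 ≤_) ys
separateOnes [] = 0 , [] , ↭-refl , []
separateOnes {suc zero ∷ _} (_ ∷ xs≥1) with separateOnes xs≥1
... | a , ys , xs↭ , ys≥2 = suc a , ys , prep 1 xs↭ , ys≥2
separateOnes {suc (suc x) ∷ _} (_ ∷ xs≥1) with separateOnes xs≥1
... | a , ys , xs↭ , ys≥2 =
  a , suc (suc x) ∷ ys , ↭-trans (prep _ xs↭) (↭-sym (shift _ (replicate a 1) ys)) , s≤s (s≤s z≤n) ∷ ys≥2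

-- Indices of sums in C_{k;n}

IdempotentIndex : ℕ → ℕ → ℕ → Set
IdempotentIndex k n t = k ≤ t × n ∣ t

idempotentIndex? : ∀ k n t → Dec (IdempotentIndex k n t)
idempotentIndex? k n t = k ≤? t ×-dec n ∣? t

module _ (k' n : ℕ) .{{_ : NonZero n}} where

  private
    ρ : ℕ → ℕ
    ρ = red (suc k') n

  red-< : ∀ {m} → m < k' → ρ m ≡ m
  red-< {m} m<k' with suc m <? suc k'
  ... | yes _    = refl
  ... | no m≮k' = contradiction (s≤s m<k') m≮k'

  red-≥ : ∀ {m} → k' ≤ m → ρ m ≡ k' + (m ∸ k') % n
  red-≥ {m} k'≤m with suc m <? suc k'
  ... | yes m<k' = contradiction k'≤m (<⇒≱ (s<s⁻¹ m<k'))
  ... | no _     = refl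

  red-canonical : ∀ {m} → m < k' + n → ρ m ≡ m
  red-canonical {m} m<k'+n with m <? k'
  ... | yes m<k' = red-< m<k'
  ... | no m≮k'  = begin
    ρ m                ≡⟨ red-≥ k'≤m ⟩
    k' + (m ∸ k') % n  ≡⟨ cong (k' +_) (m<n⇒m%n≡m (m<n+o⇒m∸n<o m k' m<k'+n)) ⟩
    k' + (m ∸ k')      ≡⟨ m+[n∸m]≡n k'≤m ⟩
    m                  ∎
    where
    open ≡-Reasoning
    k'≤m = ≮⇒≥ m≮k'

  red-below : ∀ {m} → ρ m < k' → ρ m ≡ m
  red-below {m} ρm<k' with m <? k'
  ... | yes m<k' = red-< m<k'
  ... | no m≮k'  = contradiction (subst (_< k') (red-≥ (≮⇒≥ m≮k')) ρm<k') (m+n≮m k' _)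

  red-+-red : ∀ x y → ρ (x + ρ y) ≡ ρ (x + y)
  red-+-red x y with y <? k'
  ... | yes y<k' = cong (ρ ∘ (x +_)) (red-< y<k')
  ... | no y≮k'  = begin
    ρ (x + ρ y)                   ≡⟨ cong (ρ ∘ (x +_)) (red-≥ k'≤y) ⟩
    ρ (x + (k' + r))              ≡⟨ red-≥ (≤-trans (m≤m+n k' r) (m≤n+m _ x)) ⟩
    k' + (x + (k' + r) ∸ k') % n  ≡⟨ cong (λ z → k' + (z ∸ k') % n) (x∙yz≈y∙xz x k' r) ⟩
    k' + (k' + (x + r) ∸ k') % n  ≡⟨ cong (λ z → k' + z % n) (m+n∸m≡n k' (x + r)) ⟩
    k' + (x + r) % n              ≡⟨ cong (k' +_) (%-+-cong {x} n refl (m%n%n≡m%n (y ∸ k') n)) ⟩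
    k' + (x + (y ∸ k')) % n       ≡⟨ cong (λ z → k' + z % n) (+-∸-assoc x k'≤y) ⟨
    k' + (x + y ∸ k') % n         ≡⟨ red-≥ (≤-trans k'≤y (m≤n+m y x)) ⟨
    ρ (x + y)                     ∎
    where
    open ≡-Reasoning
    k'≤y = ≮⇒≥ y≮k'
    r = (y ∸ k') % n

  red-double : ∀ m → ρ (suc (ρ m + ρ m)) ≡ ρ (suc (m + m))
  red-double m = begin
    ρ (suc (ρ m + ρ m))  ≡⟨ red-+-red (suc (ρ m)) m ⟩
    ρ (suc (ρ m + m))    ≡⟨ cong (ρ ∘ suc) (+-comm (ρ m) m) ⟩
    ρ (suc (m + ρ m))    ≡⟨ red-+-red (suc m) m ⟩
    ρ (suc (m + m))      ∎
    where open ≡-Reasoning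

  red-double≡red⇔ : ∀ m → ρ (suc (m + m)) ≡ ρ m ⇔ IdempotentIndex (suc k') n (suc m)
  red-double≡red⇔ m with m <? k'
  ... | yes m<k' = mk⇔ (λ eq → contradiction (m≡1+2m eq) (<⇒≢ (s≤s (m≤m+n m m))))
                       (λ (k≤1+m , _) → contradiction (s≤s⁻¹ k≤1+m) (<⇒≱ m<k'))
    where
    m≡1+2m : ρ (suc (m + m)) ≡ ρ m → m ≡ suc (m + m)
    m≡1+2m eq = trans (sym eq′) (red-below (subst (_< k') (sym eq′) m<k'))
      where eq′ = trans eq (red-< m<k')
  ... | no m≮k' = mk⇔ to from
    where
    k'≤m = ≮⇒≥ m≮k'
    r = m ∸ k'
    unfold : ρ (suc (m + m)) ≡ k' + (suc m + r) % n
    unfold = trans (red-≥ (≤-trans k'≤m (≤-trans (m≤m+n m m) (n≤1+n _))))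
                   (cong (λ z → k' + z % n) (+-∸-assoc (suc m) k'≤m))
    to : ρ (suc (m + m)) ≡ ρ m → IdempotentIndex (suc k') n (suc m)
    to eq = s≤s k'≤m , m%n≡0⇒n∣m (suc m) n (trans (%-cancelˡ-+ r n (begin
      (r + suc m) % n  ≡⟨ cong (_% n) (+-comm r (suc m)) ⟩
      (suc m + r) % n  ≡⟨ +-cancelˡ-≡ k' _ _ (trans (sym unfold) (trans eq (red-≥ k'≤m))) ⟩
      r % n            ≡⟨ cong (_% n) (+-identityʳ r) ⟨
      (r + 0) % n      ∎)) (m*n%n≡0 0 n))
      where open ≡-Reasoning
    from : IdempotentIndex (suc k') n (suc m) → ρ (suc (m + m)) ≡ ρ m
    from (_ , n∣1+m) = trans unfold (trans (cong (k' +_) (%-remove-+ˡ r n∣1+m)) (sym (red-≥ k'≤m)))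

  toℕ-σ⁺ : (a : C (suc k') n) (as : List (C (suc k') n)) →
           toℕ (idx (σ⁺ a as)) ≡ ρ (toℕ (idx a) + sum (map Ind as))
  toℕ-σ⁺ a []       = sym (trans (cong ρ (+-identityʳ _)) (red-canonical (toℕ<n (idx a))))
  toℕ-σ⁺ a (b ∷ bs) = begin
    toℕ (idx (a ⊕ σ⁺ b bs))        ≡⟨ toℕ-fromℕ< _ ⟩
    ρ (suc i + toℕ (idx (σ⁺ b bs)))  ≡⟨ cong (ρ ∘ (suc i +_)) (toℕ-σ⁺ b bs) ⟩
    ρ (suc i + ρ (j + Σbs))          ≡⟨ red-+-red (suc i) (j + Σbs) ⟩
    ρ (suc i + (j + Σbs))            ≡⟨ cong ρ (+-suc i (j + Σbs)) ⟨
    ρ (i + (suc j + Σbs))            ∎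
    where
    open ≡-Reasoning
    i = toℕ (idx a)
    j = toℕ (idx b)
    Σbs = sum (map Ind bs)

  σ⁺-idempotent⇔ : (a : C (suc k') n) (as : List (C (suc k') n)) →
                   idx (σ⁺ a as ⊕ σ⁺ a as) ≡ idx (σ⁺ a as) ⇔ IdempotentIndex (suc k') n (sum (map Ind (a ∷ as)))
  σ⁺-idempotent⇔ a as = mk⇔ (Equivalence.to (red-double≡red⇔ m) ∘ reduce)
                            (lift ∘ Equivalence.from (red-double≡red⇔ m))
    where
    m = toℕ (idx a) + sum (map Ind as)
    s = σ⁺ a as
    doubled : toℕ (idx (s ⊕ s)) ≡ ρ (suc (m + m))
    doubled = trans (toℕ-fromℕ< _) (trans (cong (λ z → ρ (suc (z + z))) (toℕ-σ⁺ a as)) (red-double m))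
    reduce : idx (s ⊕ s) ≡ idx s → ρ (suc (m + m)) ≡ ρ m
    reduce eq = trans (sym doubled) (trans (cong toℕ eq) (toℕ-σ⁺ a as))
    lift : ρ (suc (m + m)) ≡ ρ m → idx (s ⊕ s) ≡ idx s
    lift eq = toℕ-injective (trans doubled (trans eq (sym (toℕ-σ⁺ a as))))

-- Counting subsequences with idempotent sum

𝟙 : ∀ {a} {A : Set a} → Dec A → ℕ
𝟙 (yes _) = 1
𝟙 (no _)  = 0

𝟙-yes : ∀ {a} {A : Set a} → A → (A? : Dec A) → 𝟙 A? ≡ 1
𝟙-yes _ (yes _) = refl
𝟙-yes a (no ¬a) = contradiction a ¬a

𝟙-no : ∀ {a} {A : Set a} → ¬ A → (A? : Dec A) → 𝟙 A? ≡ 0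
𝟙-no ¬a (yes a) = contradiction a ¬a
𝟙-no _  (no _)  = refl

-- countIdem k n xs c is the number of subsequences S of xs (by position, the empty one
-- included) for which c + ΣS is an idempotent index.
countIdem : (k n : ℕ) → List ℕ → ℕ → ℕ
countIdem k n []       c = 𝟙 (idempotentIndex? k n c)
countIdem k n (x ∷ xs) c = countIdem k n xs (c + x) + countIdem k n xs c

countIdem-subseqs : ∀ {A : Set} k n (w : A → ℕ) c (T : List A) →
  sum (map (λ S → 𝟙 (idempotentIndex? k n (c + sum (map w S)))) (subseqs T)) ≡ countIdem k n (map w T) c
countIdem-subseqs k n w c []      = trans (+-identityʳ _) (cong (𝟙 ∘ idempotentIndex? k n) (+-identityʳ c))
countIdem-subseqs k n w c (x ∷ T) = begin
  sum (map (f c) (map (x ∷_) ss ++ ss))                 ≡⟨ cong sum (map-++ (f c) (map (x ∷_) ss) ss) ⟩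
  sum (map (f c) (map (x ∷_) ss) ++ map (f c) ss)       ≡⟨ sum-++ (map (f c) (map (x ∷_) ss)) (map (f c) ss) ⟩
  sum (map (f c) (map (x ∷_) ss)) + sum (map (f c) ss)  ≡⟨ cong (λ z → sum z + sum (map (f c) ss))
                                                                (trans (sym (map-∘ ss)) (map-cong cons ss)) ⟩
  sum (map (f (c + w x)) ss) + sum (map (f c) ss)       ≡⟨ cong₂ _+_ (countIdem-subseqs k n w (c + w x) T)
                                                                     (countIdem-subseqs k n w c T) ⟩
  countIdem k n (map w (x ∷ T)) c                       ∎
  where
  open ≡-Reasoning
  ss = subseqs T
  f : ℕ → List _ → ℕ
  f c S = 𝟙 (idempotentIndex? k n (c + sum (map w S)))
  cons : ∀ S → f c (x ∷ S) ≡ f (c + w x) S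
  cons S = cong (𝟙 ∘ idempotentIndex? k n) (sym (+-assoc c (w x) (sum (map w S))))

module _ {k' n : ℕ} .{{_ : NonZero n}} where

  count𝐞≡sum𝟙 : (Ss : List (List (C (suc k') n))) →
               count𝐞 Ss ≡ sum (map (λ S → 𝟙 (idempotentIndex? (suc k') n (sum (map Ind S)))) Ss)
  count𝐞≡sum𝟙 []        = refl
  count𝐞≡sum𝟙 ([] ∷ Ss) = cong₂ _+_ (sym (𝟙-no (λ ()) (idempotentIndex? (suc k') n 0))) (count𝐞≡sum𝟙 Ss)
  count𝐞≡sum𝟙 ((a ∷ as) ∷ Ss) with idx (σ⁺ a as ⊕ σ⁺ a as) ≟F idx (σ⁺ a as)
  ... | yes idem = cong₂ _+_ (sym (𝟙-yes (Equivalence.to (σ⁺-idempotent⇔ k' n a as) idem) _))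
                             (count𝐞≡sum𝟙 Ss)
  ... | no ¬idem = cong₂ _+_ (sym (𝟙-no (¬idem ∘ Equivalence.from (σ⁺-idempotent⇔ k' n a as)) _))
                             (count𝐞≡sum𝟙 Ss)

  N𝐞≡countIdem : (T : List (C (suc k') n)) → N𝐞 T ≡ countIdem (suc k') n (map Ind T) 0
  N𝐞≡countIdem T = trans (count𝐞≡sum𝟙 (subseqs T)) (countIdem-subseqs (suc k') n Ind 0 T)

Ind-positive : ∀ {k n} (T : List (C k n)) → All (1 ≤_) (map Ind T)
Ind-positive []      = []
Ind-positive (_ ∷ T) = s≤s z≤n ∷ Ind-positive T

module _ (k n : ℕ) where

  countIdem-↭ : ∀ {xs ys} → xs ↭ ys → ∀ c → countIdem k n xs c ≡ countIdem k n ys c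
  countIdem-↭ ↭-refl        c = refl
  countIdem-↭ (prep x p)    c = cong₂ _+_ (countIdem-↭ p (c + x)) (countIdem-↭ p c)
  countIdem-↭ (↭-trans p q) c = trans (countIdem-↭ p c) (countIdem-↭ q c)
  countIdem-↭ {x ∷ y ∷ xs} {_ ∷ _ ∷ ys} (swap _ _ p) c = begin
    (N xs (c + x + y) + N xs (c + x)) + (N xs (c + y) + N xs c)
      ≡⟨ cong₂ _+_ (cong₂ _+_ (countIdem-↭ p (c + x + y)) (countIdem-↭ p (c + x)))
                   (cong₂ _+_ (countIdem-↭ p (c + y)) (countIdem-↭ p c)) ⟩
    (N ys (c + x + y) + N ys (c + x)) + (N ys (c + y) + N ys c)
      ≡⟨ cong (λ z → (N ys z + N ys (c + x)) + (N ys (c + y) + N ys c)) (xy∙z≈xz∙y c x y) ⟩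
    (N ys (c + y + x) + N ys (c + x)) + (N ys (c + y) + N ys c)
      ≡⟨ interchange (N ys (c + y + x)) (N ys (c + x)) (N ys (c + y)) (N ys c) ⟩
    (N ys (c + y + x) + N ys (c + y)) + (N ys (c + x) + N ys c)
      ∎
    where
    open ≡-Reasoning
    N = countIdem k n

  countIdem-pos : ∀ {G F} c → G ⊆ F → IdempotentIndex k n (c + sum G) → 1 ≤ countIdem k n F c
  countIdem-pos c []           idem = ≤-reflexive (sym (𝟙-yes (subst (IdempotentIndex k n) (+-identityʳ c) idem) _))
  countIdem-pos c (y ∷ʳ G⊆F)   idem = ≤-trans (countIdem-pos c G⊆F idem) (m≤n+m _ _)
  countIdem-pos {x ∷ G} c (refl ∷ G⊆F) idem =
    ≤-trans (countIdem-pos (c + x) G⊆F (subst (IdempotentIndex k n) (sym (+-assoc c x (sum G))) idem)) (m≤m+n _ _)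

  module _ {R : ℕ → Set} {F : List ℕ} (covers : ∀ {c} → 1 ≤ c → R c → 1 ≤ countIdem k n F c) where

    countIdem-doubling⁺ : ∀ {P c} → All (λ x → ∀ {c} → R c → R (c + x)) P →
                          1 ≤ c → R c → 2 ^ length P ≤ countIdem k n (P ++ F) c
    countIdem-doubling⁺ []                     c≥1 Rc = covers c≥1 Rc
    countIdem-doubling⁺ {x ∷ P} {c} (Rx ∷ RP) c≥1 Rc =
      +-mono-≤ (countIdem-doubling⁺ RP (≤-trans c≥1 (m≤m+n c x)) (Rx Rc))
               (≤-trans (≤-reflexive (+-identityʳ _)) (countIdem-doubling⁺ RP c≥1 Rc))

    countIdem-doubling : ∀ {P c} → All (1 ≤_) P → All (λ x → ∀ {c} → R c → R (c + x)) P →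
                         R c → 2 ^ length P ≤ suc (countIdem k n (P ++ F) c)
    countIdem-doubling []                       []        Rc = s≤s z≤n
    countIdem-doubling {x ∷ P} {c} (x≥1 ∷ P≥1) (Rx ∷ RP) Rc =
      ≤-trans (+-mono-≤ (countIdem-doubling⁺ RP (≤-trans x≥1 (m≤n+m x c)) (Rx Rc))
                        (≤-trans (≤-reflexive (+-identityʳ _)) (countIdem-doubling P≥1 RP Rc)))
              (≤-reflexive (+-suc _ _))

-- Residues reachable by subsums

module Residues (n : ℕ) .{{_ : NonZero n}} where

  record Reachable (D : List ℕ) (r : ℕ) : Set where
    constructor reach
    field subsum : Any (λ G → sum G % n ≡ r % n) (subseqs D)

  reachable? : ∀ D r → Dec (Reachable D r)
  reachable? D r = map′ reach Reachable.subsum (any? (λ G → sum G % n ≟ r % n) (subseqs D))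

  reachable-resp : ∀ {D r s} → r % n ≡ s % n → Reachable D r → Reachable D s
  reachable-resp r≡s (reach G) = reach (Any.map (λ G≡r → trans G≡r r≡s) G)

  reachable-0 : ∀ D → Reachable D 0
  reachable-0 D = reach (lose ([]∈subseqs D) refl)

  reachable-skip : ∀ {D r} x → Reachable D r → Reachable (x ∷ D) r
  reachable-skip {D} x (reach G) = reach (++⁺ʳ (map (x ∷_) (subseqs D)) G)

  reachable-take : ∀ {D r} x → Reachable D r → Reachable (x ∷ D) (x + r)
  reachable-take x (reach G) = reach (++⁺ˡ (map⁺ (Any.map (%-+-cong {x} n refl) G)))

  reachable-ones : ∀ r → Reachable (replicate (pred n) 1) r
  reachable-ones r = reach (lose (replicate∈subseqs 1 (<⇒≤pred (m%n<n r n))) Σ≡r)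
    where
    Σ≡r : sum (replicate (r % n) 1) % n ≡ r % n
    Σ≡r = trans (cong (_% n) (trans (sum-replicate (r % n) 1) (*-identityʳ (r % n)))) (m%n%n≡m%n r n)

  unreachable-beyond-sum : ∀ {D r} → sum D < r → r < n → ¬ Reachable D r
  unreachable-beyond-sum {D} {r} ΣD<r r<n (reach G) with find G
  ... | G , G∈ , G≡r = contradiction (trans (sym (m<n⇒m%n≡m ΣG<n)) (trans G≡r (m<n⇒m%n≡m r<n))) (<⇒≢ ΣG<r)
    where
    ΣG<r = ≤-<-trans (sum-mono-⊆ (∈subseqs⇒⊆ {xs = D} G∈)) ΣD<r
    ΣG<n = <-trans ΣG<r r<n

  Stable : List ℕ → ℕ → Set
  Stable D c = ∀ r → Reachable D r → Reachable D (r + c)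

  stable-0 : ∀ {D} → Stable D 0
  stable-0 r = reachable-resp (cong (_% n) (sym (+-identityʳ r)))

  stable-+ : ∀ {D a b} → Stable D a → Stable D b → Stable D (a + b)
  stable-+ {a = a} {b} sa sb r = reachable-resp (cong (_% n) (+-assoc r a b)) ∘ sb (r + a) ∘ sa r

  stable-sum : ∀ {D L} → All (Stable D) L → Stable D (sum L)
  stable-sum []         = stable-0
  stable-sum (sx ∷ sxs) = stable-+ sx (stable-sum sxs)

  stable-multiple : ∀ {D v} → Stable D v → ∀ j → Reachable D (j * v)
  stable-multiple {D} sv zero        = reachable-0 D
  stable-multiple {D} {v} sv (suc j) = reachable-resp (cong (_% n) (+-comm (j * v) v)) (sv (j * v) (stable-multiple sv j))

  stable-ones : ∀ xs → All (Stable (replicate (pred n) 1)) xs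
  stable-ones = All.universal (λ x r _ → reachable-ones (r + x))

  stable-∷ : ∀ {D y} x → Stable D y → Stable (x ∷ D) y
  stable-∷ {D} {y} x sy r (reach G) with ++⁻ (map (x ∷_) (subseqs D)) G
  ... | inj₂ inD = reachable-skip x (sy r (reach inD))
  ... | inj₁ viaX with find (map⁻ viaX)
  ...   | G , G∈ , x+G≡r = reachable-resp x+G+y≡r+y (reachable-take x (sy (sum G) (reach (lose G∈ refl))))
    where
    x+G+y≡r+y : (x + (sum G + y)) % n ≡ (r + y) % n
    x+G+y≡r+y = trans (cong (_% n) (sym (+-assoc x (sum G) y))) (%-+-cong {c = y} n x+G≡r refl)

  stable-or-witness : ∀ D x → Stable D x ⊎ ∃ λ r → Reachable D r × ¬ Reachable D (r + x)
  stable-or-witness D x with Fin.any? (λ i → reachable? D (toℕ i) ×-dec ¬? (reachable? D (toℕ i + x)))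
  ... | yes (i , i∈ , i+x∉) = inj₂ (toℕ i , i∈ , i+x∉)
  ... | no none = inj₁ stable
    where
    stable : Stable D x
    stable r r∈ = decide (reachable? D (toℕ i + x))
      where
      i = fromℕ< (m%n<n r n)
      i≡r : toℕ i % n ≡ r % n
      i≡r = trans (cong (_% n) (toℕ-fromℕ< _)) (m%n%n≡m%n r n)
      decide : Dec (Reachable D (toℕ i + x)) → Reachable D (r + x)
      decide (yes i+x∈) = reachable-resp (%-+-cong {c = x} n i≡r refl) i+x∈
      decide (no i+x∉)  = contradiction (i , reachable-resp (sym i≡r) r∈ , i+x∉) none

  reachableSet : List ℕ → Subset n
  reachableSet D = tabulate (λ i → does (reachable? D (toℕ i)))

  ∈-reachableSet⁺ : ∀ D {i} → Reachable D (toℕ i) → i ∈ₛ reachableSet D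
  ∈-reachableSet⁺ D {i} i∈ = lookup⇒[]= i _ (trans (lookup∘tabulate _ i) (dec-true (reachable? D (toℕ i)) i∈))

  ∈-reachableSet⁻ : ∀ D {i} → i ∈ₛ reachableSet D → Reachable D (toℕ i)
  ∈-reachableSet⁻ D {i} i∈ = decide (reachable? D (toℕ i)) (trans (sym (lookup∘tabulate _ i)) ([]=⇒lookup i∈))
    where
    decide : (i∈D? : Dec (Reachable D (toℕ i))) → does i∈D? ≡ inside → Reachable D (toℕ i)
    decide (yes i∈D) _ = i∈D

  reachableSet-⊂ : ∀ {D x r} → Reachable D r → ¬ Reachable D (r + x) → reachableSet D ⊂ reachableSet (x ∷ D)
  reachableSet-⊂ {D} {x} {r} r∈ r+x∉ =
    ∈-reachableSet⁺ (x ∷ D) ∘ reachable-skip x ∘ ∈-reachableSet⁻ D ,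
    j , ∈-reachableSet⁺ (x ∷ D) (reachable-resp (trans (cong (_% n) (+-comm x r)) r+x≡j) (reachable-take x r∈)) ,
    r+x∉ ∘ reachable-resp (sym r+x≡j) ∘ ∈-reachableSet⁻ D
    where
    j = fromℕ< (m%n<n (r + x) n)
    r+x≡j : (r + x) % n ≡ toℕ j % n
    r+x≡j = trans (sym (m%n%n≡m%n (r + x) n)) (cong (_% n) (sym (toℕ-fromℕ< _)))

  replicate-bounded : ∀ {a} → a < n → length (replicate a 1) < ∣ reachableSet (replicate a 1) ∣
  replicate-bounded {zero} _ = subst (_< ∣ reachableSet [] ∣) (∣⊥∣≡0 n)
    (p⊂q⇒∣p∣<∣q∣ (⊥⊆ , zero′ , ∈-reachableSet⁺ [] (reachable-resp 0≡zero′ (reachable-0 [])) , ∉⊥))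
    where
    zero′ = fromℕ< (>-nonZero⁻¹ n)
    0≡zero′ : 0 % n ≡ toℕ zero′ % n
    0≡zero′ = cong (_% n) (sym (toℕ-fromℕ< _))
  replicate-bounded {suc a} 1+a<n = ≤-trans (s≤s (replicate-bounded (<-trans (n<1+n a) 1+a<n)))
    (p⊂q⇒∣p∣<∣q∣ (reachableSet-⊂ {replicate a 1} a∈ (unreachable-beyond-sum Σ<a+1 a+1<n)))
    where
    Σ≡a : sum (replicate a 1) ≡ a
    Σ≡a = trans (sum-replicate a 1) (*-identityʳ a)
    a∈ : Reachable (replicate a 1) a
    a∈ = reach (lose (replicate∈subseqs 1 {a} ≤-refl) (cong (_% n) Σ≡a))
    Σ<a+1 : sum (replicate a 1) < a + 1
    Σ<a+1 = subst (_< a + 1) (sym Σ≡a) (m<m+n a (s≤s z≤n))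
    a+1<n : a + 1 < n
    a+1<n = subst (_< n) (+-comm 1 a) 1+a<n

  record Split (D₀ Y : List ℕ) : Set where
    field
      pool added : List ℕ
      perm       : Y ↭ pool ++ added
      bounded    : length (added ++ D₀) < ∣ reachableSet (added ++ D₀) ∣
      stable     : All (Stable (added ++ D₀)) pool

  -- A single greedy pass suffices because, by stable-∷, an element of the pool stays
  -- stable when later elements are added to D.
  split : ∀ D₀ Y → length D₀ < ∣ reachableSet D₀ ∣ → Split D₀ Y
  split D₀ []      D₀-bounded = record { pool = []; added = []; perm = ↭-refl; bounded = D₀-bounded; stable = [] }
  split D₀ (x ∷ Y) D₀-bounded with split D₀ Y D₀-bounded
  ... | s with stable-or-witness (Split.added s ++ D₀) x
  ...   | inj₁ x-stable = record
          { pool = x ∷ pool; added = added; perm = prep x perm; bounded = bounded; stable = x-stable ∷ stable }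
    where open Split s
  ...   | inj₂ (r , r∈ , r+x∉) = record
          { pool = pool; added = x ∷ added; perm = ↭-trans (prep x perm) (↭-sym (shift x pool added))
          ; bounded = ≤-trans (s≤s bounded) (p⊂q⇒∣p∣<∣q∣ (reachableSet-⊂ r∈ r+x∉))
          ; stable = All.map (stable-∷ x) stable }
    where open Split s

-- n + t plays the role of ⌈k/n⌉ n.
module Covering (n : ℕ) .{{_ : NonZero n}} (k t : ℕ) (k≤n+t : k ≤ n + t) (n∣t : n ∣ t) where
  open Residues n

  -- v = c + ΣL is stable, so -v ≡ (n - 1) v is the residue of the sum of some G ⊆ D.
  covering : ∀ {D L} → All (Stable D) L → t ≤ sum L →
             ∀ {c} → 1 ≤ c → Stable D c → 1 ≤ countIdem k n (L ++ D) c
  covering {D} {L} L-stable t≤ΣL {c} c≥1 c-stable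
    with find (Reachable.subsum (stable-multiple (stable-+ c-stable (stable-sum L-stable)) (pred n)))
  ... | G , G∈ , G≡[n-1]v =
    countIdem-pos k n c (⊆-++⁺ (⊆-refl {x = L}) (∈subseqs⇒⊆ {xs = D} G∈)) (subst (IdempotentIndex k n) w≡ idem)
    where
    v = c + sum L
    w = v + sum G
    w≡ : w ≡ c + sum (L ++ G)
    w≡ = trans (+-assoc c (sum L) (sum G)) (cong (c +_) (sym (sum-++ L G)))
    n∣w : n ∣ w
    n∣w = m%n≡0⇒n∣m w n (begin
      (v + sum G) % n         ≡⟨ %-+-cong {v} n refl G≡[n-1]v ⟩
      (suc (pred n) * v) % n  ≡⟨ cong (λ z → (z * v) % n) (suc-pred n) ⟩
      (n * v) % n             ≡⟨ n∣m⇒m%n≡0 _ n (m∣m*n v) ⟩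
      0                       ∎)
      where open ≡-Reasoning
    t<w : t < w
    t<w = ≤-trans (s≤s t≤ΣL) (≤-trans (+-monoˡ-≤ (sum L) c≥1) (m≤m+n v (sum G)))
    idem : IdempotentIndex k n w
    idem = ≤-trans k≤n+t (multiples-gap n∣t n∣w t<w) , n∣w

  decomposition-bound : ∀ {M} δ P L D → M ↭ P ++ (L ++ D) → All (1 ≤_) M →
    All (Stable D) P → All (Stable D) L → t ≤ sum L → length L + length D + 1 + δ ≤ n + t →
    2 ^ (length M + 1 + δ ∸ (n + t)) ≤ suc (countIdem k n M 0)
  decomposition-bound {M} δ P L D M↭ M≥1 P-stable L-stable t≤ΣL size = begin
    2 ^ (length M + 1 + δ ∸ (n + t))       ≤⟨ ^-monoʳ-≤ 2 (m≤n+o⇒m∸n≤o _ (n + t) exponent) ⟩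
    2 ^ length P                           ≤⟨ countIdem-doubling k n (covering L-stable t≤ΣL)
                                                                 P≥1 P-preserving stable-0 ⟩
    suc (countIdem k n (P ++ (L ++ D)) 0)  ≡⟨ cong suc (countIdem-↭ k n (↭-sym M↭) 0) ⟩
    suc (countIdem k n M 0)                ∎
    where
    open ≤-Reasoning
    P≥1 = ++⁻ˡ P (All-resp-↭ M↭ M≥1)
    P-preserving : All (λ x → ∀ {c} → Stable D c → Stable D (c + x)) P
    P-preserving = All.map (λ x-stable {c} c-stable → stable-+ {D} {c} c-stable x-stable) P-stable
    |M| : length M ≡ length P + (length L + length D)
    |M| = trans (↭-length M↭) (trans (length-++ P) (cong (length P +_) (length-++ L)))
    exponent : length M + 1 + δ ≤ n + t + length P
    exponent = begin
      length M + 1 + δ                          ≡⟨ cong (λ m → m + 1 + δ) |M| ⟩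
      length P + (length L + length D) + 1 + δ  ≡⟨ cong (_+ δ) (+-assoc (length P) _ 1) ⟩
      length P + (length L + length D + 1) + δ  ≡⟨ +-assoc (length P) _ δ ⟩
      length P + (length L + length D + 1 + δ)  ≤⟨ +-monoʳ-≤ (length P) size ⟩
      length P + (n + t)                        ≡⟨ +-comm (length P) (n + t) ⟩
      n + t + length P                          ∎

module Bound (n : ℕ) .{{_ : NonZero n}} (k t δ : ℕ) (k≤n+t : k ≤ n + t) (n∣t : n ∣ t)
             (δ-small : 2 * δ + 2 * n ≤ t + 1) where
  open Residues n
  open Covering n k t k≤n+t n∣t

  size-bound : ∀ {l d} → 2 * l ≤ t + 1 → d < n → l + d + 1 + δ ≤ n + t
  size-bound {l} {d} 2l≤ d<n = begin
    l + d + 1 + δ  ≡⟨ regroup l d δ ⟩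
    l + δ + suc d  ≤⟨ +-monoʳ-≤ (l + δ) d<n ⟩
    l + δ + n      ≤⟨ *-cancelˡ-≤ 2 (begin
      2 * (l + δ + n)          ≡⟨ double l δ n ⟩
      2 * l + (2 * δ + 2 * n)  ≤⟨ +-mono-≤ 2l≤ δ-small ⟩
      (t + 1) + (t + 1)        ≡⟨ cong (t + 1 +_) (+-identityʳ (t + 1)) ⟨
      2 * (t + 1)              ∎) ⟩
    t + 1          ≤⟨ +-monoʳ-≤ t (>-nonZero⁻¹ n) ⟩
    t + n          ≡⟨ +-comm t n ⟩
    n + t          ∎
    where
    open ≤-Reasoning
    regroup : ∀ l d δ → l + d + 1 + δ ≡ l + δ + suc d
    regroup = solve-∀
    double : ∀ l δ n → 2 * (l + δ + n) ≡ 2 * l + (2 * δ + 2 * n)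
    double = solve-∀

  pool-heavy : ∀ {p d} → n + t ≤ p + d + δ → d < n → t ≤ 2 * p
  pool-heavy {p} {d} n+t≤ d<n = ≤-trans (m≤m+n t (2 * n)) (+-cancelʳ-≤ (2 * n + (t + 2 * δ)) _ _ (begin
    t + 2 * n + (2 * n + (t + 2 * δ))  ≡⟨ e₁ t n δ ⟩
    2 * (n + t) + (2 * δ + 2 * n)      ≤⟨ +-mono-≤ (*-monoʳ-≤ 2 n+t≤) δ-small ⟩
    2 * (p + d + δ) + (t + 1)          ≡⟨ e₂ p d δ t ⟩
    2 * p + (2 * d + 1 + (t + 2 * δ))  ≤⟨ +-monoʳ-≤ (2 * p) (+-monoˡ-≤ (t + 2 * δ) 2d+1≤2n) ⟩
    2 * p + (2 * n + (t + 2 * δ))      ∎))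
    where
    open ≤-Reasoning
    e₁ : ∀ t n δ → t + 2 * n + (2 * n + (t + 2 * δ)) ≡ 2 * (n + t) + (2 * δ + 2 * n)
    e₁ = solve-∀
    e₂ : ∀ p d δ t → 2 * (p + d + δ) + (t + 1) ≡ 2 * p + (2 * d + 1 + (t + 2 * δ))
    e₂ = solve-∀
    e₃ : ∀ d → 2 * d + 1 + 1 ≡ 2 * suc d
    e₃ = solve-∀
    2d+1≤2n : 2 * d + 1 ≤ 2 * n
    2d+1≤2n = ≤-trans (m≤m+n _ 1) (≤-trans (≤-reflexive (e₃ d)) (*-monoʳ-≤ 2 d<n))

  padding-fits : ∀ {s y z} → n + t ≤ pred n + s + y + δ → y + δ ≤ z → t ∸ z ≤ s
  padding-fits {s} {y} {z} n+t≤ y+δ≤z = m≤n+o⇒m∸n≤o t z (<⇒≤ (+-cancelˡ-≤ (pred n) _ _ (begin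
    pred n + suc t        ≡⟨ +-suc (pred n) t ⟩
    suc (pred n) + t      ≡⟨ cong (_+ t) (suc-pred n) ⟩
    n + t                 ≤⟨ n+t≤ ⟩
    pred n + s + y + δ    ≡⟨ +-assoc (pred n + s) y δ ⟩
    pred n + s + (y + δ)  ≤⟨ +-monoʳ-≤ (pred n + s) y+δ≤z ⟩
    pred n + s + z        ≡⟨ +-assoc (pred n) s z ⟩
    pred n + (s + z)      ≡⟨ cong (pred n +_) (+-comm s z) ⟩
    pred n + (z + s)      ∎)))
    where open ≤-Reasoning

  padded-size : ∀ {y z j} → y + δ ≤ z → z + j ≡ t → y + j + pred n + 1 + δ ≤ n + t
  padded-size {y} {z} {j} y+δ≤z z+j≡t = begin
    y + j + pred n + 1 + δ    ≡⟨ regroup y j (pred n) δ ⟩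
    y + δ + j + suc (pred n)  ≤⟨ +-monoˡ-≤ (suc (pred n)) (+-monoˡ-≤ j y+δ≤z) ⟩
    z + j + suc (pred n)      ≡⟨ cong₂ _+_ z+j≡t (suc-pred n) ⟩
    t + n                     ≡⟨ +-comm t n ⟩
    n + t                     ∎
    where
    open ≤-Reasoning
    regroup : ∀ y j m δ → y + j + m + 1 + δ ≡ y + δ + j + suc m
    regroup = solve-∀

  many-ones-heavy : ∀ {M s Y} → M ↭ replicate (pred n + s) 1 ++ Y → All (1 ≤_) M → All (2 ≤_) Y → t ≤ sum Y →
                    2 ^ (length M + 1 + δ ∸ (n + t)) ≤ suc (countIdem k n M 0)
  many-ones-heavy {M} {s} {Y} M↭ M≥1 Y≥2 t≤ΣY with shortPrefix t Y Y≥2 t≤ΣY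
  ... | L , R , refl , t≤ΣL , 2|L|≤ =
    decomposition-bound δ (R ++ S) L O perm M≥1 (stable-ones (R ++ S)) (stable-ones L) t≤ΣL
      (subst (λ d → length L + d + 1 + δ ≤ n + t) (sym (length-replicate (pred n)))
             (size-bound 2|L|≤ (≤-reflexive (suc-pred n))))
    where
    O = replicate (pred n) 1
    S = replicate s 1
    perm : M ↭ (R ++ S) ++ (L ++ O)
    perm = ↭-trans M↭ (subst (λ Z → Z ++ (L ++ R) ↭ (R ++ S) ++ (L ++ O)) (sym (replicate-+ (pred n) s 1))
             (solve 4 (λ O S L R → (O ⊎ₗ S) ⊎ₗ (L ⊎ₗ R) ⊜ (R ⊎ₗ S) ⊎ₗ (L ⊎ₗ O)) ↭-refl O S L R))

  many-ones-light : ∀ {M s Y} → M ↭ replicate (pred n + s) 1 ++ Y → All (1 ≤_) M →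
                    length Y + δ ≤ sum Y → n + t ≤ length M + δ → sum Y < t →
                    2 ^ (length M + 1 + δ ∸ (n + t)) ≤ suc (countIdem k n M 0)
  many-ones-light {M} {s} {Y} M↭ M≥1 Y-heavy n+t≤ ΣY<t =
    decomposition-bound δ Rest (Y ++ J) O perm M≥1 (stable-ones Rest) (stable-ones (Y ++ J))
                        (≤-reflexive (sym ΣY+J≡t)) size
    where
    j = t ∸ sum Y
    O = replicate (pred n) 1
    J = replicate j 1
    Rest = replicate (s ∸ j) 1
    ΣY+j≡t : sum Y + j ≡ t
    ΣY+j≡t = m+[n∸m]≡n (<⇒≤ ΣY<t)
    ΣY+J≡t : sum (Y ++ J) ≡ t
    ΣY+J≡t = trans (sum-++ Y J) (trans (cong (sum Y +_) (trans (sum-replicate j 1) (*-identityʳ j))) ΣY+j≡t)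
    j≤s : j ≤ s
    j≤s = padding-fits (subst (λ m → n + t ≤ m + δ) (trans (↭-length M↭) (length-replicate-++ (pred n + s))) n+t≤)
                       Y-heavy
    ones : replicate (pred n + s) 1 ≡ O ++ (J ++ Rest)
    ones = trans (cong (λ z → replicate (pred n + z) 1) (sym (m+[n∸m]≡n j≤s)))
                 (trans (replicate-+ (pred n) (j + (s ∸ j)) 1) (cong (O ++_) (replicate-+ j (s ∸ j) 1)))
    perm : M ↭ Rest ++ ((Y ++ J) ++ O)
    perm = ↭-trans M↭ (subst (λ Z → Z ++ Y ↭ Rest ++ ((Y ++ J) ++ O)) (sym ones)
             (solve 4 (λ O J Rest Y → (O ⊎ₗ (J ⊎ₗ Rest)) ⊎ₗ Y ⊜ Rest ⊎ₗ ((Y ⊎ₗ J) ⊎ₗ O))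
                    ↭-refl O J Rest Y))
    size : length (Y ++ J) + length O + 1 + δ ≤ n + t
    size = subst (_≤ n + t)
                 (sym (cong₂ (λ a b → a + b + 1 + δ) (trans (length-++ Y) (cong (length Y +_) (length-replicate j)))
                                                     (length-replicate (pred n))))
                 (padded-size Y-heavy ΣY+j≡t)

  many-ones : ∀ {M s Y} → M ↭ replicate (pred n + s) 1 ++ Y → All (1 ≤_) M → All (2 ≤_) Y →
              length Y + δ ≤ sum Y → n + t ≤ length M + δ →
              2 ^ (length M + 1 + δ ∸ (n + t)) ≤ suc (countIdem k n M 0)
  many-ones {Y = Y} M↭ M≥1 Y≥2 Y-heavy n+t≤ with t ≤? sum Y
  ... | yes t≤ΣY = many-ones-heavy M↭ M≥1 Y≥2 t≤ΣY
  ... | no t≰ΣY  = many-ones-light M↭ M≥1 Y-heavy n+t≤ (≰⇒> t≰ΣY)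

  few-ones-pool : ∀ {M} pool D → M ↭ pool ++ D → All (1 ≤_) M → All (2 ≤_) pool → All (Stable D) pool →
                  length D < n → t ≤ sum pool → 2 ^ (length M + 1 + δ ∸ (n + t)) ≤ suc (countIdem k n M 0)
  few-ones-pool {M} pool D M↭ M≥1 pool≥2 pool-stable |D|<n t≤Σpool with shortPrefix t pool pool≥2 t≤Σpool
  ... | L , P , refl , t≤ΣL , 2|L|≤ =
    decomposition-bound δ P L D perm M≥1 (++⁻ʳ L pool-stable) (++⁻ˡ L pool-stable) t≤ΣL (size-bound 2|L|≤ |D|<n)
    where
    perm : M ↭ P ++ (L ++ D)
    perm = ↭-trans M↭ (solve 3 (λ L P D → (L ⊎ₗ P) ⊎ₗ D ⊜ P ⊎ₗ (L ⊎ₗ D)) ↭-refl L P D)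

  few-ones : ∀ {M a Y} → M ↭ replicate a 1 ++ Y → All (1 ≤_) M → All (2 ≤_) Y → a < n →
             n + t ≤ length M + δ → 2 ^ (length M + 1 + δ ∸ (n + t)) ≤ suc (countIdem k n M 0)
  few-ones {M} {a} {Y} M↭ M≥1 Y≥2 a<n n+t≤ = few-ones-pool pool D perm M≥1 pool≥2 stable |D|<n t≤Σpool
    where
    O = replicate a 1
    open Split (split O Y (replicate-bounded a<n)) renaming (perm to Y↭)
    D = added ++ O
    perm : M ↭ pool ++ D
    perm = ↭-trans M↭ (↭-trans (↭-++⁺ˡ O Y↭)
             (solve 3 (λ O P A → O ⊎ₗ (P ⊎ₗ A) ⊜ P ⊎ₗ (A ⊎ₗ O)) ↭-refl O pool added))
    pool≥2 : All (2 ≤_) pool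
    pool≥2 = ++⁻ˡ pool (All-resp-↭ Y↭ Y≥2)
    |D|<n : length D < n
    |D|<n = <-≤-trans bounded (∣p∣≤n (reachableSet D))
    t≤Σpool : t ≤ sum pool
    t≤Σpool = ≤-trans (pool-heavy (subst (λ m → n + t ≤ m + δ) (trans (↭-length perm) (length-++ pool)) n+t≤) |D|<n)
                      (2*length≤sum pool≥2)

  bound : ∀ {M a Y} → M ↭ replicate a 1 ++ Y → All (1 ≤_) M → All (2 ≤_) Y → δ ≤ excess Y →
          2 ^ (length M + 1 + δ ∸ (n + t)) ≤ suc (countIdem k n M 0)
  bound {M} {a} {Y} M↭ M≥1 Y≥2 δ≤exY with n + t ≤? length M + δ | a <? n
  ... | no short | _ = subst (λ e → 2 ^ e ≤ suc (countIdem k n M 0)) (sym (m≤n⇒m∸n≡0 M-short)) (s≤s z≤n)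
    where
    M-short : length M + 1 + δ ≤ n + t
    M-short = subst (_≤ n + t) (cong (_+ δ) (+-comm 1 (length M))) (≰⇒> short)
  ... | yes n+t≤ | yes a<n = few-ones M↭ M≥1 Y≥2 a<n n+t≤
  ... | yes n+t≤ | no a≮n  =
    many-ones (subst (λ a → M ↭ replicate a 1 ++ Y) (sym (m+[n∸m]≡n n-1≤a)) M↭) M≥1 Y≥2 Y-heavy n+t≤
    where
    n-1≤a : pred n ≤ a
    n-1≤a = ≤-trans pred[n]≤n (≮⇒≥ a≮n)
    Y-heavy : length Y + δ ≤ sum Y
    Y-heavy = subst (length Y + δ ≤_) (sym (sum≡length+excess (All.map (≤-trans (n≤1+n 1)) Y≥2)))
                    (+-monoʳ-≤ (length Y) δ≤exY)

mainTheorem2 : (k n : ℕ) → .{{_ : NonZero n}} → n < k →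
    (T : List (C k n)) → T ≢ [] →
    (δ : ℕ) → 1 ≤ δ →
    2 * δ + 3 * n ≤ 2 * ⌈ ⌈ k / n ⌉ * n / 2 ⌉ →
    suc (N𝐞 T) < 2 ^ (length T + 1 + δ ∸ ⌈ k / n ⌉ * n) →
    Σ (List ℕ) λ xs →
      (map Ind T ↭ replicate (length T ∸ length xs) 1 ++ xs)
      × All (λ x → 2 ≤ x) xs
      × length xs ≤ sum (map (λ x → x ∸ 1) xs)
      × sum (map (λ x → x ∸ 1) xs) ≤ δ ∸ 1
mainTheorem2 zero      _ ()
mainTheorem2 (suc k') n _ T _ δ _ δ-bound N-bound with ⌈ suc k' / n ⌉ | m≤⌈m/n⌉*n (suc k') n
... | zero  | ()
... | suc p | k≤K with separateOnes (Ind-positive T)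
...   | a , xs , T↭ , xs≥2 = xs , perm , xs≥2 , length≤excess xs≥2 , excess≤δ-1
  where
  open Bound n (suc k') (p * n) δ k≤K (n∣m*n p) (δ-bound⇒δ-small n (p * n) δ δ-bound)
  perm : map Ind T ↭ replicate (length T ∸ length xs) 1 ++ xs
  perm = subst (λ m → map Ind T ↭ replicate (m ∸ length xs) 1 ++ xs) (length-map Ind T)
               (subst (λ a → map Ind T ↭ replicate a 1 ++ xs) (sym (↭-replicate-++⇒length∸ T↭)) T↭)
  excess≤δ-1 : excess xs ≤ δ ∸ 1
  excess≤δ-1 with excess xs ≤? δ ∸ 1
  ... | yes ok = ok
  ... | no big = contradiction counted (<⇒≱ N-bound)
    where
    counted : 2 ^ (length T + 1 + δ ∸ (n + p * n)) ≤ suc (N𝐞 T)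
    counted = subst₂ (λ m N → 2 ^ (m + 1 + δ ∸ (n + p * n)) ≤ suc N) (length-map Ind T) (sym (N𝐞≡countIdem T))
                     (bound T↭ (Ind-positive T) xs≥2 (≤-trans (m≤n+m∸n δ 1) (≰⇒> big)))
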